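{- Let $\mathcal{A}$ be an allotment of an LBDD instance. Then $\mathcal{A}$ is an optimal allotment if and only if $\mathcal{A}$ does not induce any negative cost loop.
   Context: An instance of the Load Balanced Demand Distribution (LBDD) problem consists of: a finite set $S=\{s_1,\dots,s_k\}$ of service centers ($k\ge 2$); a finite set $D$ of $n$ demand units; a cost matrix $\mathcal{CM}$ giving a positive integer $\mathcal{CM}(d,s)$ for every pair $(d,s)\in D\times S$; for each $s_i$ a positive integer capacity $c_i$; and for each $s_i$ a penalty function $q_i$ on the positive integers, where $q_i(m)$ is the extra cost incurred by the $m$-th demand unit assigned to $s_i$: $q_i(m)=0$ for $m\le c_i$, and for $m>c_i$ the values $q_i(m)$ are positive and monotonically increasing in $m$ (convention $q_i(0)=0$). An allotment $\mathcal{A}$ assigns every demand unit to exactly one service center. The occupancy $o_i=o_i(\mathcal{A})$ is the number of demand units assigned to $s_i$. The cost of $\mathcal{A}$ is $\sum_{d\in D}\mathcal{CM}(d,\mathcal{A}(d))+\sum_{i=1}^{k}\sum_{m=1}^{o_i}q_i(m)$; $\mathcal{A}$ is optimal if it has minimum cost among all allotments. The allotment subspace multigraph $\Gamma(\mathcal{A})$ has vertex set $S$ and, for each demand unit $dn$ assigned to $s_i$ and each $s_j\neq s_i$, a directed transfer edge $(s_i,s_j,dn)$ of cost $\mathcal{CM}(dn,s_j)-\mathcal{CM}(dn,s_i)$. The penalty transfer edge from $s_x$ to $s_y$ ($x\ne y$) has weight $q_x(o_x+1)-q_y(o_y)$. A loop induced by $\mathcal{A}$ from $s_i$ to $s_j$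 ($s_i\neq s_j$) consists of a directed path $P$ in $\Gamma(\mathcal{A})$ from $s_i$ to $s_j$ with pairwise distinct vertices, closed either (i) by a transfer edge of $\Gamma(\mathcal{A})$ from $s_j$ to $s_i$, the loop's cost being the sum of the costs of all its transfer edges; or (ii) by the penalty transfer edge from $s_j$ to $s_i$, the loop's cost being the sum of the costs of the edges of $P$ plus $q_j(o_j+1)-q_i(o_i)$. A loop is negative (a negative cost loop) if its cost is less than zero. -}

module Defs where

open import Data.Nat as ℕ using (ℕ; zero; suc; _≤_; _<_)
open import Data.Integer as ℤ using (ℤ; +_)
open import Data.Fin using (Fin; zero; suc)
open import Data.Fin.Properties using (_≟_)
open import Data.List using (List; []; _∷_)
open import Data.List.Relation.Unary.Unique.Propositional using (Unique)
open import Data.Product using (Σ; _×_)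
open import Data.Sum using (_⊎_)
open import Relation.Binary.PropositionalEquality using (_≡_; _≢_)
open import Relation.Nullary using (yes; no)

sumFin : (m : ℕ) → (Fin m → ℕ) → ℕ
sumFin zero    f = 0
sumFin (suc m) f = f zero ℕ.+ sumFin m (λ x → f (suc x))

-- An LBDD instance: service centers are Fin k (k ≥ 2), demand units are Fin n.
record Instance : Set where
  field
    k      : ℕ
    2≤k    : 2 ≤ k
    n      : ℕ
    CM     : Fin n → Fin k → ℕ
    CM-pos : ∀ d s → 0 < CM d s
    cap    : Fin k → ℕ
    cap-pos : ∀ i → 0 < cap i
    -- q i m : extra cost of the m-th demand unit assigned to s_i
    q      : Fin k → ℕ → ℕ
    q-free : ∀ i m → m ≤ cap i → q i m ≡ 0
    q-pos  : ∀ i m → cap i < m → 0 < q i m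
    q-mono : ∀ i m m′ → cap i < m → m ≤ m′ → q i m ≤ q i m′

module _ (I : Instance) where
  open Instance I

  Allotment : Set
  Allotment = Fin n → Fin k

  occ : Allotment → Fin k → ℕ
  occ A i = sumFin n (λ d → indicator (A d ≟ i))
    where
    indicator : ∀ {P : Set} → Relation.Nullary.Dec P → ℕ
    indicator (yes _) = 1
    indicator (no _)  = 0

  penaltySum : Fin k → ℕ → ℕ
  penaltySum i zero    = 0
  penaltySum i (suc o) = penaltySum i o ℕ.+ q i (suc o)

  cost : Allotment → ℕ
  cost A = sumFin n (λ d → CM d (A d)) ℕ.+ sumFin k (λ i → penaltySum i (occ A i))

  Optimal : Allotment → Set
  Optimal A = ∀ (B : Allotment) → cost A ≤ cost B

  -- cost of transfer edge (s_a, s_b, d) where d is assigned to s_a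
  edgeCost : Fin n → Fin k → Fin k → ℤ
  edgeCost d a b = + CM d b ℤ.- + CM d a

  penaltyEdge : Allotment → Fin k → Fin k → ℤ
  penaltyEdge A x y = + q x (suc (occ A x)) ℤ.- + q y (occ A y)

  data Path (A : Allotment) : Fin k → Fin k → Set where
    edge : (d : Fin n) {a b : Fin k} → A d ≡ a → a ≢ b → Path A a b
    step : (d : Fin n) {a b c : Fin k} → A d ≡ a → a ≢ b → Path A b c → Path A a c

  vertices : ∀ {A a b} → Path A a b → List (Fin k)
  vertices (edge d {a} {b} _ _)  = a ∷ b ∷ []
  vertices (step d {a} _ _ p)    = a ∷ vertices p

  pathCost : ∀ {A a b} → Path A a b → ℤ
  pathCost (edge d {a} {b} _ _)     = edgeCost d a b
  pathCost (step d {a} {b} _ _ p)   = edgeCost d a b ℤ.+ pathCost p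

  data Closing (A : Allotment) (i j : Fin k) : Set where
    transferClose : (d : Fin n) → A d ≡ j → Closing A i j
    penaltyClose  : Closing A i j

  closingCost : ∀ {A i j} → Closing A i j → ℤ
  closingCost {A} {i} {j} (transferClose d _) = edgeCost d j i
  closingCost {A} {i} {j} penaltyClose        = penaltyEdge A j i

  record Loop (A : Allotment) : Set where
    field
      i j     : Fin k
      i≢j     : i ≢ j
      path    : Path A i j
      simple  : Unique (vertices path)
      closing : Closing A i j

  loopCost : ∀ {A} → Loop A → ℤ
  loopCost L = pathCost path ℤ.+ closingCost closing
    where open Loop L

  NegativeLoop : Allotment → Set
  NegativeLoop A = Σ (Loop A) (λ L → loopCost L ℤ.< + 0)

{-# OPTIONS --safe #-}
module Submission where

-- Moving one unit d from s_u to s_v changes the cost by CM(d,v) - CM(d,u) + q_v(o_v+1) - q_u(o_u),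
-- i.e. by a transfer edge plus a penalty edge. Shifting every unit of a simple path one edge forward,
-- the intermediate penalty terms telescope, so applying a loop (after first moving the closing unit,
-- for a transfer-closed loop) changes the cost by exactly the loop's cost: an optimal allotment
-- induces no negative loop.
--
-- Conversely, let B differ from A. Starting at a centre s_j with more units under B than under A
-- (or at any misplaced unit if there is none), walk backwards in Γ(A) along units that B has moved
-- into the current vertex. Either a vertex repeats, which closes a loop by a transfer edge, or the
-- walk stops at a centre s_u into which B moves no unit, so o_u(B) < o_u(A); together with
-- o_j(A) < o_j(B) and the monotonicity of the penalties, undoing the path in B then saves at least
-- the cost of the loop closed by the penalty edge s_j → s_u. Either way, moving the loop's units back
-- to their places under A costs no more than B and misplaces fewer units, so induction on the number
-- of misplaced units gives cost A ≤ cost B.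

open import Defs
open import Data.Fin as Fin using (Fin; zero; suc; punchIn)
open import Data.Fin.Properties using (_≟_; punchInᵢ≢i; any?; pigeonhole)
open import Data.Integer as ℤ using (ℤ; +_)
import Data.Integer.Properties as ℤP
import Data.Integer.Tactic.RingSolver as ℤ-Solver
open import Data.Nat as ℕ using (ℕ; zero; suc; _≤_; _<_; z≤n; s≤s)
import Data.Nat.Properties as ℕP
open import Algebra.Properties.CommutativeMonoid.Sum ℕP.+-0-commutativeMonoid
  using (sum; sum-cong-≗; sum-remove; sum-replicate-zero; ∑-comm)
open import Data.Nat.Tactic.RingSolver using (solve-∀)
open import Data.Vec.Functional using (updateAt)
open import Data.Vec.Functional.Properties using (updateAt-updates; updateAt-minimal)
open import Function.Base using (_∘_; const; flip)
open import Function.Bundles using (_⇔_; mk⇔)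
open import Relation.Binary.PropositionalEquality
open import Relation.Nullary using (Dec; yes; no; ¬_; ¬?)
open import Relation.Nullary.Decidable using (_×-dec_; decidable-stable)
open import Data.Sum using (_⊎_; inj₁; inj₂)
open import Data.Empty using (⊥-elim)
open import Data.List using (List; []; _∷_; length; lookup)
open import Data.List.Membership.Propositional using (_∈_)
open import Data.List.Membership.Propositional.Properties using (∈-lookup)
open import Data.List.Relation.Binary.Subset.Propositional using (_⊆_)
open import Data.List.Relation.Unary.All as All using (All; []; _∷_)
open import Data.List.Relation.Unary.All.Properties using (anti-mono; ¬Any⇒All¬)
open import Data.List.Relation.Unary.AllPairs using ([]; _∷_)
open import Data.List.Relation.Unary.Any using (here; there)
open import Data.List.Relation.Unary.Unique.Propositional using (Unique)
open import Data.Product using (Σ-syntax; _×_; _,_; proj₂)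

indicator : ∀ {P : Set} → Dec P → ℕ
indicator (yes _) = 1
indicator (no _)  = 0

indicator-yes : ∀ {P : Set} → P → (p : Dec P) → indicator p ≡ 1
indicator-yes x (yes _) = refl
indicator-yes x (no ¬x) = ⊥-elim (¬x x)

indicator-no : ∀ {P : Set} → ¬ P → (p : Dec P) → indicator p ≡ 0
indicator-no ¬x (yes x) = ⊥-elim (¬x x)
indicator-no ¬x (no _)  = refl

indicator-mono : ∀ {P Q : Set} → (P → Q) → (p : Dec P) (q : Dec Q) → indicator p ≤ indicator q
indicator-mono P⇒Q (yes x) q = ℕP.≤-reflexive (sym (indicator-yes (P⇒Q x) q))
indicator-mono P⇒Q (no _)  q = z≤n

sumFin≡sum : ∀ m (f : Fin m → ℕ) → sumFin m f ≡ sum f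
sumFin≡sum zero    f = refl
sumFin≡sum (suc m) f = cong (f zero ℕ.+_) (sumFin≡sum m (f ∘ suc))

sum-mono-≤ : ∀ {m} {f g : Fin m → ℕ} → (∀ x → f x ≤ g x) → sum f ≤ sum g
sum-mono-≤ {zero}  f≤g = z≤n
sum-mono-≤ {suc m} f≤g = ℕP.+-mono-≤ (f≤g zero) (sum-mono-≤ (f≤g ∘ suc))

sum-mono-< : ∀ {m} {f g : Fin m → ℕ} → (∀ x → f x ≤ g x) → ∀ x → f x < g x → sum f < sum g
sum-mono-< {suc m} {f} {g} f≤g x fx<gx = begin-strict
  sum f                          ≡⟨ sum-remove f ⟩
  f x ℕ.+ sum (λ y → f (punchIn x y)) <⟨ ℕP.+-mono-<-≤ fx<gx (sum-mono-≤ (f≤g ∘ punchIn x)) ⟩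
  g x ℕ.+ sum (λ y → g (punchIn x y)) ≡⟨ sum-remove g ⟨
  sum g                          ∎
  where open ℕP.≤-Reasoning

sum-update : ∀ {m} {f g : Fin m → ℕ} x {a b} → (∀ y → y ≢ x → f y ≡ g y) →
             f x ℕ.+ a ≡ g x ℕ.+ b → sum f ℕ.+ a ≡ sum g ℕ.+ b
sum-update {suc m} {f} {g} x {a} {b} f≗g fx+a≡gx+b = begin
  sum f ℕ.+ a                  ≡⟨ cong (ℕ._+ a) (sum-remove f) ⟩
  f x ℕ.+ rest f ℕ.+ a          ≡⟨ swap (f x) (rest f) a ⟩
  f x ℕ.+ a ℕ.+ rest f          ≡⟨ cong₂ ℕ._+_ fx+a≡gx+b rest-f≡rest-g ⟩
  g x ℕ.+ b ℕ.+ rest g          ≡⟨ swap (g x) b (rest g) ⟩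
  g x ℕ.+ rest g ℕ.+ b          ≡⟨ cong (ℕ._+ b) (sum-remove g) ⟨
  sum g ℕ.+ b                  ∎
  where
  open ≡-Reasoning
  rest : (Fin (suc m) → ℕ) → ℕ
  rest h = sum (h ∘ punchIn x)
  rest-f≡rest-g : rest f ≡ rest g
  rest-f≡rest-g = sum-cong-≗ (λ y → f≗g (punchIn x y) (punchInᵢ≢i x y))
  swap : ∀ p r s → p ℕ.+ r ℕ.+ s ≡ p ℕ.+ s ℕ.+ r
  swap = solve-∀

sum-update₂ : ∀ {m} {f g : Fin m → ℕ} u v {a b} → u ≢ v →
              (∀ y → y ≢ u → y ≢ v → f y ≡ g y) →
              f u ℕ.+ a ≡ g u → f v ≡ g v ℕ.+ b → sum f ℕ.+ a ≡ sum g ℕ.+ b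
sum-update₂ {f = f} {g} u v {a} {b} u≢v f≗g fu+a≡gu fv≡gv+b = begin
  sum f ℕ.+ a           ≡⟨ cong (ℕ._+ a) f-to-h ⟩
  sum h ℕ.+ b ℕ.+ a     ≡⟨ swap (sum h) b a ⟩
  sum h ℕ.+ a ℕ.+ b     ≡⟨ cong (ℕ._+ b) h-to-g ⟩
  sum g ℕ.+ b           ∎
  where
  open ≡-Reasoning
  h = updateAt g u (const (f u))
  f-to-h : sum f ≡ sum h ℕ.+ b
  f-to-h = trans (sym (ℕP.+-identityʳ (sum f)))
                 (sum-update v f≗h (trans (ℕP.+-identityʳ (f v))
                   (trans fv≡gv+b (cong (ℕ._+ b) (sym (updateAt-minimal v u g (u≢v ∘ sym)))))))
    where
    f≗h : ∀ y → y ≢ v → f y ≡ h y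
    f≗h y y≢v with y ≟ u
    ... | yes refl = sym (updateAt-updates u g)
    ... | no y≢u = trans (f≗g y y≢u y≢v) (sym (updateAt-minimal y u g y≢u))
  h-to-g : sum h ℕ.+ a ≡ sum g
  h-to-g = trans (sum-update u (λ y y≢u → updateAt-minimal y u g y≢u)
                   (trans (cong (ℕ._+ a) (updateAt-updates u g)) (trans fu+a≡gu (sym (ℕP.+-identityʳ (g u))))))
                 (ℕP.+-identityʳ (sum g))
  swap : ∀ p r s → p ℕ.+ r ℕ.+ s ≡ p ℕ.+ s ℕ.+ r
  swap = solve-∀

sum-indicator-≟ : ∀ {m} (x : Fin m) → sum (λ i → indicator (x ≟ i)) ≡ 1
sum-indicator-≟ {suc m} x = begin
  sum (λ i → indicator (x ≟ i))
    ≡⟨ sum-remove (λ i → indicator (x ≟ i)) ⟩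
  indicator (x ≟ x) ℕ.+ sum (λ y → indicator (x ≟ punchIn x y))
    ≡⟨ cong₂ ℕ._+_ (indicator-yes refl (x ≟ x)) others ⟩
  1 ∎
  where
  open ≡-Reasoning
  others : sum (λ y → indicator (x ≟ punchIn x y)) ≡ 0
  others = trans (sum-cong-≗ (λ y → indicator-no (punchInᵢ≢i x y ∘ sym) (x ≟ punchIn x y)))
                 (sum-replicate-zero m)

unique-lookup : ∀ {A : Set} {xs : List A} → Unique xs →
                ∀ {i j} → i Fin.< j → lookup xs i ≢ lookup xs j
unique-lookup {xs = _ ∷ _} (x∉xs ∷ _)  {zero}  {suc j} _         = All.lookup x∉xs (∈-lookup j)
unique-lookup {xs = _ ∷ _} (_ ∷ xs-uq) {suc i} {suc j} (s≤s i<j) = unique-lookup xs-uq i<j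

length-unique-≤ : ∀ {m} {xs : List (Fin m)} → Unique xs → length xs ≤ m
length-unique-≤ {m} {xs} xs-uq with length xs ℕ.≤? m
... | yes fits    = fits
... | no too-long with pigeonhole (ℕP.≰⇒> too-long) (lookup xs)
...   | _ , _ , i<j , same = ⊥-elim (unique-lookup xs-uq i<j same)

sum-ones : ∀ m → sum {m} (λ _ → 1) ≡ m
sum-ones zero    = refl
sum-ones (suc m) = cong suc (sum-ones m)

balance⇒difference : ∀ {a b c c′ e e′} → a ℕ.+ c ℕ.+ e ≡ b ℕ.+ c′ ℕ.+ e′ →
              + a ≡ + b ℤ.+ ((+ c′ ℤ.- + c) ℤ.+ (+ e′ ℤ.- + e))
balance⇒difference {a} {b} {c} {c′} {e} {e′} eq = begin
  + a                                          ≡⟨ cancel (+ a) (+ c) (+ e) ⟩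
  + a ℤ.+ + c ℤ.+ + e ℤ.- + c ℤ.- + e          ≡⟨ cong (λ z → z ℤ.- + c ℤ.- + e) lifted ⟩
  + b ℤ.+ + c′ ℤ.+ + e′ ℤ.- + c ℤ.- + e        ≡⟨ regroup (+ b) (+ c) (+ c′) (+ e) (+ e′) ⟩
  + b ℤ.+ ((+ c′ ℤ.- + c) ℤ.+ (+ e′ ℤ.- + e))  ∎
  where
  open ≡-Reasoning
  pos-+₃ : ∀ x y z → + (x ℕ.+ y ℕ.+ z) ≡ + x ℤ.+ + y ℤ.+ + z
  pos-+₃ x y z = trans (ℤP.pos-+ (x ℕ.+ y) z) (cong (ℤ._+ + z) (ℤP.pos-+ x y))
  lifted : + a ℤ.+ + c ℤ.+ + e ≡ + b ℤ.+ + c′ ℤ.+ + e′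
  lifted = trans (sym (pos-+₃ a c e)) (trans (cong +_ eq) (pos-+₃ b c′ e′))
  cancel : ∀ x y z → x ≡ x ℤ.+ y ℤ.+ z ℤ.- y ℤ.- z
  cancel = ℤ-Solver.solve-∀
  regroup : ∀ x y y′ z z′ → x ℤ.+ y′ ℤ.+ z′ ℤ.- y ℤ.- z ≡ x ℤ.+ ((y′ ℤ.- y) ℤ.+ (z′ ℤ.- z))
  regroup = ℤ-Solver.solve-∀

+≡+δ⇒≤ : ∀ {m n δ} → + m ≡ + n ℤ.+ δ → + 0 ℤ.≤ δ → n ≤ m
+≡+δ⇒≤ {m} {n} {δ} m≡n+δ 0≤δ = ℤP.drop‿+≤+ (subst (+ n ℤ.≤_) (sym m≡n+δ)
  (subst (ℤ._≤ + n ℤ.+ δ) (ℤP.+-identityʳ (+ n)) (ℤP.+-monoʳ-≤ (+ n) 0≤δ)))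

+≡+δ⇒< : ∀ {m n δ} → + m ≡ + n ℤ.+ δ → δ ℤ.< + 0 → m < n
+≡+δ⇒< {m} {n} {δ} m≡n+δ δ<0 = ℤP.drop‿+<+ (subst (ℤ._< + n) (sym m≡n+δ)
  (subst (+ n ℤ.+ δ ℤ.<_) (ℤP.+-identityʳ (+ n)) (ℤP.+-monoʳ-< (+ n) δ<0)))

module _ (I : Instance) where
  open Instance I
  open import Data.List.Membership.DecPropositional (_≟_ {k}) using (_∈?_)

  mutual
    occ≡sum : ∀ (X : Allotment I) i → occ I X i ≡ sum (λ d → indicator (X d ≟ i))
    occ≡sum X i = trans (sumFin≡sum n _) (sum-cong-≗ (indicator-pointwise X i))

    -- The left-hand side is the indicator local to `occ`, which cannot be named here.
    indicator-pointwise : ∀ (X : Allotment I) i d → _ ≡ indicator (X d ≟ i)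
    indicator-pointwise X i d with X d ≟ i
    ... | yes _ = refl
    ... | no _  = refl

  sum-occ : ∀ (X : Allotment I) → sum (occ I X) ≡ n
  sum-occ X = begin
    sum (occ I X)                                   ≡⟨ sum-cong-≗ (occ≡sum X) ⟩
    sum (λ i → sum (λ d → indicator (X d ≟ i)))    ≡⟨ ∑-comm (λ i d → indicator (X d ≟ i)) ⟩
    sum (λ d → sum (λ i → indicator (X d ≟ i)))    ≡⟨ sum-cong-≗ (sum-indicator-≟ ∘ X) ⟩
    sum {n} (λ _ → 1)                               ≡⟨ sum-ones n ⟩
    n                                               ∎
    where open ≡-Reasoning

  occ-mono-≤ : ∀ {X Y : Allotment I} {u} → (∀ d → X d ≡ u → Y d ≡ u) → occ I X u ≤ occ I Y u
  occ-mono-≤ {X} {Y} {u} X⇒Y = subst₂ _≤_ (sym (occ≡sum X u)) (sym (occ≡sum Y u))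
    (sum-mono-≤ (λ d → indicator-mono (X⇒Y d) (X d ≟ u) (Y d ≟ u)))

  occ-mono-< : ∀ {X Y : Allotment I} {u} d → (∀ d → X d ≡ u → Y d ≡ u) → X d ≢ u → Y d ≡ u →
               occ I X u < occ I Y u
  occ-mono-< {X} {Y} {u} d X⇒Y Xd≢u Yd≡u = subst₂ _<_ (sym (occ≡sum X u)) (sym (occ≡sum Y u))
    (sum-mono-< (λ d → indicator-mono (X⇒Y d) (X d ≟ u) (Y d ≟ u)) d
      (subst₂ _<_ (sym (indicator-no Xd≢u (X d ≟ u))) (sym (indicator-yes Yd≡u (Y d ≟ u))) ℕP.≤-refl))

  move : Allotment I → Fin n → Fin k → Allotment I
  move X d v = updateAt X d (const v)

  move-moves : ∀ X d v → move X d v d ≡ v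
  move-moves X d v = updateAt-updates d X

  move-elsewhere : ∀ X {d d′} v → d′ ≢ d → move X d v d′ ≡ X d′
  move-elsewhere X {d} {d′} v = updateAt-minimal d′ d X

  move-keeps : ∀ {X d d′ x y} v → X d ≡ x → X d′ ≡ y → x ≢ y → move X d v d′ ≡ y
  move-keeps {X} {d} {d′} v Xd≡x Xd′≡y x≢y = trans (move-elsewhere X v d′≢d) Xd′≡y
    where
    d′≢d : d′ ≢ d
    d′≢d d′≡d = x≢y (trans (sym Xd≡x) (trans (cong X (sym d′≡d)) Xd′≡y))

  occ-move : ∀ X d v w → occ I (move X d v) w ℕ.+ indicator (X d ≟ w) ≡ occ I X w ℕ.+ indicator (v ≟ w)
  occ-move X d v w = begin
    occ I (move X d v) w ℕ.+ indicator (X d ≟ w)                   ≡⟨ cong (ℕ._+ _) (occ≡sum (move X d v) w) ⟩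
    sum (λ d′ → indicator (move X d v d′ ≟ w)) ℕ.+ indicator (X d ≟ w) ≡⟨ sum-update d unmoved moved ⟩
    sum (λ d′ → indicator (X d′ ≟ w)) ℕ.+ indicator (v ≟ w)           ≡⟨ cong (ℕ._+ _) (occ≡sum X w) ⟨
    occ I X w ℕ.+ indicator (v ≟ w)                                ∎
    where
    open ≡-Reasoning
    unmoved : ∀ d′ → d′ ≢ d → indicator (move X d v d′ ≟ w) ≡ indicator (X d′ ≟ w)
    unmoved d′ d′≢d = cong (λ z → indicator (z ≟ w)) (move-elsewhere X v d′≢d)
    moved : indicator (move X d v d ≟ w) ℕ.+ indicator (X d ≟ w) ≡ indicator (X d ≟ w) ℕ.+ indicator (v ≟ w)
    moved = trans (cong (λ z → indicator (z ≟ w) ℕ.+ indicator (X d ≟ w)) (move-moves X d v))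
                  (ℕP.+-comm (indicator (v ≟ w)) (indicator (X d ≟ w)))

  module _ {X : Allotment I} {d u v} (Xd≡u : X d ≡ u) (u≢v : u ≢ v) where

    private
      o o′ : Fin k → ℕ
      o  = occ I X
      o′ = occ I (move X d v)

    occ-move-target : o′ v ≡ suc (o v)
    occ-move-target = begin
      o′ v                              ≡⟨ ℕP.+-identityʳ (o′ v) ⟨
      o′ v ℕ.+ 0                        ≡⟨ cong (o′ v ℕ.+_) (indicator-no Xd≢v (X d ≟ v)) ⟨
      o′ v ℕ.+ indicator (X d ≟ v)      ≡⟨ occ-move X d v v ⟩
      o v ℕ.+ indicator (v ≟ v)         ≡⟨ cong (o v ℕ.+_) (indicator-yes refl (v ≟ v)) ⟩
      o v ℕ.+ 1                         ≡⟨ ℕP.+-comm (o v) 1 ⟩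
      suc (o v)                         ∎
      where
      open ≡-Reasoning
      Xd≢v : X d ≢ v
      Xd≢v = u≢v ∘ trans (sym Xd≡u)

    occ-move-source : o u ≡ suc (o′ u)
    occ-move-source = begin
      o u                               ≡⟨ ℕP.+-identityʳ (o u) ⟨
      o u ℕ.+ 0                         ≡⟨ cong (o u ℕ.+_) (indicator-no (u≢v ∘ sym) (v ≟ u)) ⟨
      o u ℕ.+ indicator (v ≟ u)         ≡⟨ occ-move X d v u ⟨
      o′ u ℕ.+ indicator (X d ≟ u)      ≡⟨ cong (o′ u ℕ.+_) (indicator-yes Xd≡u (X d ≟ u)) ⟩
      o′ u ℕ.+ 1                        ≡⟨ ℕP.+-comm (o′ u) 1 ⟩
      suc (o′ u)                        ∎
      where open ≡-Reasoning

    occ-move-other : ∀ {w} → w ≢ u → w ≢ v → o′ w ≡ o w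
    occ-move-other {w} w≢u w≢v = ℕP.+-cancelʳ-≡ 0 (o′ w) (o w) (begin
      o′ w ℕ.+ 0                        ≡⟨ cong (o′ w ℕ.+_) (indicator-no Xd≢w (X d ≟ w)) ⟨
      o′ w ℕ.+ indicator (X d ≟ w)      ≡⟨ occ-move X d v w ⟩
      o w ℕ.+ indicator (v ≟ w)         ≡⟨ cong (o w ℕ.+_) (indicator-no (w≢v ∘ sym) (v ≟ w)) ⟩
      o w ℕ.+ 0                         ∎)
      where
      open ≡-Reasoning
      Xd≢w : X d ≢ w
      Xd≢w = w≢u ∘ sym ∘ trans (sym Xd≡u)

  assignmentCost penaltyCost : Allotment I → ℕ
  assignmentCost X = sum (λ d → CM d (X d))
  penaltyCost    X = sum (λ i → penaltySum I i (occ I X i))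

  cost≡ : ∀ X → cost I X ≡ assignmentCost X ℕ.+ penaltyCost X
  cost≡ X = cong₂ ℕ._+_ (sumFin≡sum n _) (sumFin≡sum k _)

  cost-cong : ∀ {X Y : Allotment I} → (∀ d → X d ≡ Y d) → cost I X ≡ cost I Y
  cost-cong {X} {Y} X≗Y = begin
    cost I X                             ≡⟨ cost≡ X ⟩
    assignmentCost X ℕ.+ penaltyCost X   ≡⟨ cong₂ ℕ._+_ (sum-cong-≗ (λ d → cong (CM d) (X≗Y d)))
                                                        (sum-cong-≗ (λ i → cong (penaltySum I i) occ≡)) ⟩
    assignmentCost Y ℕ.+ penaltyCost Y   ≡⟨ cost≡ Y ⟨
    cost I Y                             ∎
    where
    open ≡-Reasoning
    occ≡ : ∀ {i} → occ I X i ≡ occ I Y i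
    occ≡ {i} = trans (occ≡sum X i)
      (trans (sum-cong-≗ (λ d → cong (λ z → indicator (z ≟ i)) (X≗Y d))) (sym (occ≡sum Y i)))

  q-mono-≤ : ∀ i {m m′} → m ≤ m′ → q i m ≤ q i m′
  q-mono-≤ i {m} {m′} m≤m′ with m ℕ.≤? cap i
  ... | yes m≤cap = subst (_≤ q i m′) (sym (q-free i m m≤cap)) z≤n
  ... | no  m≰cap = q-mono i m m′ (ℕP.≰⇒> m≰cap) m≤m′

  penaltySum-step : ∀ i {o o′} → o ≡ suc o′ → penaltySum I i o ≡ penaltySum I i o′ ℕ.+ q i o
  penaltySum-step i refl = refl

  module _ {X : Allotment I} {d u v} (Xd≡u : X d ≡ u) (u≢v : u ≢ v) where

    private
      Y = move X d v

    assignmentCost-move : assignmentCost Y ℕ.+ CM d u ≡ assignmentCost X ℕ.+ CM d v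
    assignmentCost-move = sum-update d (λ d′ d′≢d → cong (CM d′) (move-elsewhere X v d′≢d))
      (trans (cong (λ z → CM d z ℕ.+ CM d u) (move-moves X d v))
        (trans (ℕP.+-comm (CM d v) (CM d u)) (cong (λ z → CM d z ℕ.+ CM d v) (sym Xd≡u))))

    penaltyCost-move : penaltyCost Y ℕ.+ q u (occ I X u) ≡ penaltyCost X ℕ.+ q v (suc (occ I X v))
    penaltyCost-move = sum-update₂ u v u≢v
      (λ w w≢u w≢v → cong (penaltySum I w) (occ-move-other Xd≡u u≢v w≢u w≢v))
      (sym (penaltySum-step u (occ-move-source Xd≡u u≢v)))
      (cong (penaltySum I v) (occ-move-target Xd≡u u≢v))

    cost-move : + cost I Y ≡ + cost I X ℤ.+ (edgeCost I d u v ℤ.+ penaltyEdge I X v u)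
    cost-move = balance⇒difference (begin
      cost I Y ℕ.+ CM d u ℕ.+ qᵤ                 ≡⟨ cong (λ z → z ℕ.+ CM d u ℕ.+ qᵤ) (cost≡ Y) ⟩
      aY ℕ.+ pY ℕ.+ CM d u ℕ.+ qᵤ                ≡⟨ interchange aY pY (CM d u) qᵤ ⟩
      (aY ℕ.+ CM d u) ℕ.+ (pY ℕ.+ qᵤ)            ≡⟨ cong₂ ℕ._+_ assignmentCost-move penaltyCost-move ⟩
      (aX ℕ.+ CM d v) ℕ.+ (pX ℕ.+ qᵥ)            ≡⟨ interchange aX pX (CM d v) qᵥ ⟨
      aX ℕ.+ pX ℕ.+ CM d v ℕ.+ qᵥ                ≡⟨ cong (λ z → z ℕ.+ CM d v ℕ.+ qᵥ) (cost≡ X) ⟨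
      cost I X ℕ.+ CM d v ℕ.+ qᵥ                 ∎)
      where
      open ≡-Reasoning
      aX = assignmentCost X
      aY = assignmentCost Y
      pX = penaltyCost X
      pY = penaltyCost Y
      qᵤ = q u (occ I X u)
      qᵥ = q v (suc (occ I X v))
      interchange : ∀ a b c e → a ℕ.+ b ℕ.+ c ℕ.+ e ≡ (a ℕ.+ c) ℕ.+ (b ℕ.+ e)
      interchange = solve-∀

    cost-before-move : + cost I X ≡ + cost I Y ℤ.- (edgeCost I d u v ℤ.+ penaltyEdge I X v u)
    cost-before-move = trans (cancel (+ cost I X) δ) (cong (ℤ._- δ) (sym cost-move))
      where
      δ = edgeCost I d u v ℤ.+ penaltyEdge I X v u
      cancel : ∀ x y → x ≡ x ℤ.+ y ℤ.- y
      cancel = ℤ-Solver.solve-∀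

  module _ {A : Allotment I} where

    AllEdges : (Fin n → Fin k → Fin k → Set) → ∀ {a c} → Path I A a c → Set
    AllEdges P (edge d {a} {b} _ _)   = P d a b
    AllEdges P (step d {a} {b} _ _ p) = P d a b × AllEdges P p

    AtSources AtTargets : Allotment I → ∀ {a c} → Path I A a c → Set
    AtSources X = AllEdges (λ d a _ → X d ≡ a)
    AtTargets X = AllEdges (λ d _ b → X d ≡ b)

    AllEdges-map : ∀ {P Q} → (∀ {d a b} → P d a b → Q d a b) →
                   ∀ {a c} (p : Path I A a c) → AllEdges P p → AllEdges Q p
    AllEdges-map f (edge _ _ _)   P        = f P
    AllEdges-map f (step _ _ _ p) (P , Ps) = f P , AllEdges-map f p Ps

    AllEdges-zipWith : ∀ {P Q R} → (∀ {d a b} → P d a b → Q d a b → R d a b) →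
                       ∀ {a c} (p : Path I A a c) → AllEdges P p → AllEdges Q p → AllEdges R p
    AllEdges-zipWith f (edge _ _ _)   P Q             = f P Q
    AllEdges-zipWith f (step _ _ _ p) (P , Ps) (Q , Qs) = f P Q , AllEdges-zipWith f p Ps Qs

    atSources : ∀ {a c} (p : Path I A a c) → AtSources A p
    atSources (edge _ Ad≡a _)   = Ad≡a
    atSources (step _ Ad≡a _ p) = Ad≡a , atSources p

    source∈vertices : ∀ {a c} (p : Path I A a c) → a ∈ vertices I p
    source∈vertices (edge _ _ _)   = here refl
    source∈vertices (step _ _ _ _) = here refl

    target∈vertices : ∀ {a c} (p : Path I A a c) → c ∈ vertices I p
    target∈vertices (edge _ _ _)   = there (here refl)
    target∈vertices (step _ _ _ p) = there (target∈vertices p)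

    AllEdges-vertices : ∀ {P} {a c} (p : Path I A a c) → All P (vertices I p) → AllEdges (λ _ a b → P a × P b) p
    AllEdges-vertices (edge _ _ _)   (Pa ∷ Pb ∷ []) = Pa , Pb
    AllEdges-vertices (step _ _ _ p) (Pa ∷ Ps)      = (Pa , All.lookup Ps (source∈vertices p)) , AllEdges-vertices p Ps

    source≢target : ∀ {a c} (p : Path I A a c) → Unique (vertices I p) → a ≢ c
    source≢target (edge _ _ a≢c)  _         = a≢c
    source≢target (step _ _ _ p) (a∉p ∷ _) = All.lookup a∉p (target∈vertices p)

    sources≢target : ∀ {a c} (p : Path I A a c) → Unique (vertices I p) → AllEdges (λ _ a′ _ → a′ ≢ c) p
    sources≢target (edge _ _ a≢c)   _              = a≢c
    sources≢target (step _ _ _ p) (a∉p ∷ p-simple) =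
      All.lookup a∉p (target∈vertices p) , sources≢target p p-simple

    source≢targets : ∀ {a c} (p : Path I A a c) → Unique (vertices I p) → AllEdges (λ _ _ b → a ≢ b) p
    source≢targets (edge _ _ a≢c)   _         = a≢c
    source≢targets (step _ _ a≢b p) (a∉p ∷ _) = a≢b , AllEdges-map proj₂ p (AllEdges-vertices p a∉p)

    shift : ∀ {a c} → Path I A a c → Allotment I → Allotment I
    shift (edge d {b = b} _ _)   X = move X d b
    shift (step d {b = b} _ _ p) X = shift p (move X d b)

    cost-shift : ∀ {a c} (p : Path I A a c) {X} → Unique (vertices I p) → AtSources X p →
                 + cost I (shift p X) ≡ + cost I X ℤ.+ (pathCost I p ℤ.+ penaltyEdge I X c a)
    cost-shift (edge _ _ a≢c) _ Xd≡a = cost-move Xd≡a a≢c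
    cost-shift (step d {a} {b} {c} _ a≢b p) {X} (a∉p ∷ p-simple) (Xd≡a , Xp) = begin
      + cost I (shift p X₁)
        ≡⟨ cost-shift p p-simple X₁p ⟩
      + cost I X₁ ℤ.+ (pathCost I p ℤ.+ penaltyEdge I X₁ c b)
        ≡⟨ cong₂ (λ x y → x ℤ.+ (pathCost I p ℤ.+ y)) (cost-move Xd≡a a≢b) penaltyEdge-X₁ ⟩
      + cost I X ℤ.+ (edgeCost I d a b ℤ.+ (Q⁺ b ℤ.- Q a)) ℤ.+ (pathCost I p ℤ.+ (Q⁺ c ℤ.- Q⁺ b))
        ≡⟨ telescope (+ cost I X) (edgeCost I d a b) (pathCost I p) (Q a) (Q⁺ b) (Q⁺ c) ⟩
      + cost I X ℤ.+ ((edgeCost I d a b ℤ.+ pathCost I p) ℤ.+ (Q⁺ c ℤ.- Q a))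
        ∎
      where
      open ≡-Reasoning
      X₁ = move X d b
      Q Q⁺ : Fin k → ℤ
      Q  i = + q i (occ I X i)
      Q⁺ i = + q i (suc (occ I X i))
      X₁p : AtSources X₁ p
      X₁p = AllEdges-zipWith (λ Xd′≡a′ (a≢a′ , _) → move-keeps b Xd≡a Xd′≡a′ a≢a′)
              p Xp (AllEdges-vertices p a∉p)
      penaltyEdge-X₁ : penaltyEdge I X₁ c b ≡ Q⁺ c ℤ.- Q⁺ b
      penaltyEdge-X₁ = cong₂ (λ o o′ → + q c (suc o) ℤ.- + q b o′)
        (occ-move-other Xd≡a a≢b (All.lookup a∉p (target∈vertices p) ∘ sym) (source≢target p p-simple ∘ sym))
        (occ-move-target Xd≡a a≢b)
      telescope : ∀ x e P qa qb qc →
                  x ℤ.+ (e ℤ.+ (qb ℤ.- qa)) ℤ.+ (P ℤ.+ (qc ℤ.- qb)) ≡ x ℤ.+ ((e ℤ.+ P) ℤ.+ (qc ℤ.- qa))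
      telescope = ℤ-Solver.solve-∀

    unshift : ∀ {a c} → Path I A a c → Allotment I → Allotment I
    unshift (edge d {a} _ _)   B = move B d a
    unshift (step d {a} _ _ p) B = unshift p (move B d a)

    cost-unshift : ∀ {a c} (p : Path I A a c) {B} → Unique (vertices I p) → AtTargets B p →
                   + cost I B ≡ + cost I (unshift p B) ℤ.+ (pathCost I p ℤ.- penaltyEdge I B a c)
    cost-unshift (edge d {a} {c} _ a≢c) {B} _ Bd≡c =
      trans (cost-before-move Bd≡c (a≢c ∘ sym))
            (regroup (+ cost I (move B d a)) (+ CM d a) (+ CM d c) (penaltyEdge I B a c))
      where
      regroup : ∀ x ca cc pe → x ℤ.- ((ca ℤ.- cc) ℤ.+ pe) ≡ x ℤ.+ ((cc ℤ.- ca) ℤ.- pe)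
      regroup = ℤ-Solver.solve-∀
    cost-unshift (step d {a} {b} {c} _ a≢b p) {B} (a∉p ∷ p-simple) (Bd≡b , Bp) = begin
      + cost I B
        ≡⟨ cost-before-move Bd≡b (a≢b ∘ sym) ⟩
      + cost I B₁ ℤ.- δ
        ≡⟨ cong (ℤ._- δ) (cost-unshift p p-simple B₁p) ⟩
      + cost I R ℤ.+ (pathCost I p ℤ.- penaltyEdge I B₁ b c) ℤ.- δ
        ≡⟨ cong (λ z → + cost I R ℤ.+ (pathCost I p ℤ.- z) ℤ.- δ) penaltyEdge-B₁ ⟩
      + cost I R ℤ.+ (pathCost I p ℤ.- (Q b ℤ.- Q c)) ℤ.- δ
        ≡⟨ telescope (+ cost I R) (pathCost I p) (+ CM d a) (+ CM d b) (Q⁺ a) (Q b) (Q c) ⟩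
      + cost I R ℤ.+ ((edgeCost I d a b ℤ.+ pathCost I p) ℤ.- (Q⁺ a ℤ.- Q c))
        ∎
      where
      open ≡-Reasoning
      B₁ = move B d a
      R  = unshift p B₁
      Q Q⁺ : Fin k → ℤ
      Q  i = + q i (occ I B i)
      Q⁺ i = + q i (suc (occ I B i))
      δ = edgeCost I d b a ℤ.+ penaltyEdge I B a b
      B₁p : AtTargets B₁ p
      B₁p = AllEdges-zipWith (λ Bd′≡b′ b≢b′ → move-keeps a Bd≡b Bd′≡b′ b≢b′)
              p Bp (source≢targets p p-simple)
      penaltyEdge-B₁ : penaltyEdge I B₁ b c ≡ Q b ℤ.- Q c
      penaltyEdge-B₁ = cong₂ (λ o o′ → + q b o ℤ.- + q c o′)
        (sym (occ-move-source Bd≡b (a≢b ∘ sym)))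
        (occ-move-other Bd≡b (a≢b ∘ sym)
          (source≢target p p-simple ∘ sym) (All.lookup a∉p (target∈vertices p) ∘ sym))
      telescope : ∀ r P ca cb qa qb qc →
                  r ℤ.+ (P ℤ.- (qb ℤ.- qc)) ℤ.- ((ca ℤ.- cb) ℤ.+ (qa ℤ.- qb))
                ≡ r ℤ.+ (((cb ℤ.- ca) ℤ.+ P) ℤ.- (qa ℤ.- qc))
      telescope = ℤ-Solver.solve-∀

    distance : Allotment I → ℕ
    distance B = sum (λ d → indicator (¬? (A d ≟ B d)))

    distance-move : ∀ B d → distance (move B d (A d)) ℕ.+ indicator (¬? (A d ≟ B d)) ≡ distance B
    distance-move B d = trans
      (sum-update d (λ d′ d′≢d → cong (λ z → indicator (¬? (A d′ ≟ z))) (move-elsewhere B (A d) d′≢d))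
        (trans (cong (ℕ._+ indicator (¬? (A d ≟ B d))) moved-agrees) (ℕP.+-comm 0 _)))
      (ℕP.+-identityʳ (distance B))
      where
      moved-agrees : indicator (¬? (A d ≟ move B d (A d) d)) ≡ 0
      moved-agrees = indicator-no (λ ne → ne (sym (move-moves B d (A d)))) (¬? (A d ≟ move B d (A d) d))

    distance-move-≤ : ∀ B d {a} → A d ≡ a → distance (move B d a) ≤ distance B
    distance-move-≤ B d refl =
      subst (distance (move B d (A d)) ≤_) (distance-move B d) (ℕP.m≤m+n _ _)

    distance-move-< : ∀ B d {a} → A d ≡ a → B d ≢ a → distance (move B d a) < distance B
    distance-move-< B d refl Bd≢Ad = subst (distance (move B d (A d)) <_) (distance-move B d)
      (subst (λ i → distance (move B d (A d)) < distance (move B d (A d)) ℕ.+ i)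
        (sym (indicator-yes (Bd≢Ad ∘ sym) (¬? (A d ≟ B d)))) (ℕP.m<m+n _ (s≤s z≤n)))

    distance-unshift-≤ : ∀ {a c} (p : Path I A a c) B → distance (unshift p B) ≤ distance B
    distance-unshift-≤ (edge d Ad≡a _)   B = distance-move-≤ B d Ad≡a
    distance-unshift-≤ (step d Ad≡a _ p) B = ℕP.≤-trans (distance-unshift-≤ p _) (distance-move-≤ B d Ad≡a)

    distance-unshift-< : ∀ {a c} (p : Path I A a c) {B} → AtTargets B p → distance (unshift p B) < distance B
    distance-unshift-< (edge d Ad≡a a≢c) {B} Bd≡c =
      distance-move-< B d Ad≡a (a≢c ∘ sym ∘ trans (sym Bd≡c))
    distance-unshift-< (step d Ad≡a a≢b p) {B} (Bd≡b , _) =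
      ℕP.≤-<-trans (distance-unshift-≤ p _) (distance-move-< B d Ad≡a (a≢b ∘ sym ∘ trans (sym Bd≡b)))

    applyLoop : Loop I A → Allotment I
    applyLoop record { i = i ; path = p ; closing = transferClose d _ } = shift p (move A d i)
    applyLoop record { path = p ; closing = penaltyClose }              = shift p A

    cost-applyLoop : (L : Loop I A) → + cost I (applyLoop L) ≡ + cost I A ℤ.+ loopCost I L
    cost-applyLoop record { path = p ; simple = p-simple ; closing = penaltyClose } =
      cost-shift p p-simple (atSources p)
    cost-applyLoop record { i = i ; j = j ; i≢j = i≢j ; path = p ; simple = p-simple ; closing = transferClose d Ad≡j } =
      begin
      + cost I (shift p A₁)
        ≡⟨ cost-shift p p-simple A₁p ⟩
      + cost I A₁ ℤ.+ (pathCost I p ℤ.+ penaltyEdge I A₁ j i)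
        ≡⟨ cong₂ (λ x y → x ℤ.+ (pathCost I p ℤ.+ y)) (cost-move Ad≡j (i≢j ∘ sym)) penaltyEdge-A₁ ⟩
      + cost I A ℤ.+ (edgeCost I d j i ℤ.+ (Q⁺ i ℤ.- Q j)) ℤ.+ (pathCost I p ℤ.+ (Q j ℤ.- Q⁺ i))
        ≡⟨ penalties-cancel (+ cost I A) (edgeCost I d j i) (pathCost I p) (Q⁺ i) (Q j) ⟩
      + cost I A ℤ.+ (pathCost I p ℤ.+ edgeCost I d j i)
        ∎
      where
      open ≡-Reasoning
      A₁ = move A d i
      Q Q⁺ : Fin k → ℤ
      Q  x = + q x (occ I A x)
      Q⁺ x = + q x (suc (occ I A x))
      A₁p : AtSources A₁ p
      A₁p = AllEdges-zipWith (λ Ad′≡a′ a′≢j → move-keeps i Ad≡j Ad′≡a′ (a′≢j ∘ sym))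
              p (atSources p) (sources≢target p p-simple)
      penaltyEdge-A₁ : penaltyEdge I A₁ j i ≡ Q j ℤ.- Q⁺ i
      penaltyEdge-A₁ = cong₂ (λ o o′ → + q j o ℤ.- + q i o′)
        (sym (occ-move-source Ad≡j (i≢j ∘ sym))) (occ-move-target Ad≡j (i≢j ∘ sym))
      penalties-cancel : ∀ x e P qi qj →
                         x ℤ.+ (e ℤ.+ (qi ℤ.- qj)) ℤ.+ (P ℤ.+ (qj ℤ.- qi)) ≡ x ℤ.+ (P ℤ.+ e)
      penalties-cancel = ℤ-Solver.solve-∀

    optimal⇒no-negative-loop : Optimal I A → ¬ NegativeLoop I A
    optimal⇒no-negative-loop A-optimal (L , L<0) =
      ℕP.<⇒≱ (+≡+δ⇒< (cost-applyLoop L) L<0) (A-optimal (applyLoop L))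

    prefix : ∀ {P u j x} (p : Path I A u j) → x ∈ vertices I p → x ≢ u → Unique (vertices I p) → AllEdges P p →
             Σ[ r ∈ Path I A u x ] Unique (vertices I r) × AllEdges P r × vertices I r ⊆ vertices I p
    prefix (edge _ _ _)   (here refl)                 x≢u = ⊥-elim (x≢u refl)
    prefix (edge d e u≢j) (there (here refl))         _   p-simple Pd = edge d e u≢j , p-simple , Pd , λ y∈ → y∈
    prefix (step _ _ _ _) (here refl)                 x≢u = ⊥-elim (x≢u refl)
    prefix {x = x} (step d {b = b} e u≢b p) (there x∈p) x≢u (u∉p ∷ p-simple) (Pd , Pp) with x ≟ b
    ... | yes refl = edge d e u≢b , (u≢b ∷ []) ∷ [] ∷ [] , Pd , λ where
                       (here refl)         → here refl
                       (there (here refl)) → there (source∈vertices p)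
    ... | no x≢b with prefix p x∈p x≢b p-simple Pp
    ...   | r , r-simple , Pr , r⊆p = step d e u≢b r , anti-mono r⊆p u∉p ∷ r-simple , (Pd , Pr) , λ where
                       (here refl) → here refl
                       (there y∈r) → there (r⊆p y∈r)

    moved-into? : ∀ (B : Allotment I) u → (Σ[ d ∈ Fin n ] B d ≡ u × A d ≢ u) ⊎ (∀ d → B d ≡ u → A d ≡ u)
    moved-into? B u with any? (λ d → B d ≟ u ×-dec ¬? (A d ≟ u))
    ... | yes moved = inj₁ moved
    ... | no  none  = inj₂ (λ d Bd≡u → decidable-stable (A d ≟ u) (λ Ad≢u → none (d , Bd≡u , Ad≢u)))

    occ-source-< : ∀ {B u j} (p : Path I A u j) → AtTargets B p → (∀ d → B d ≡ u → A d ≡ u) →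
                   occ I B u < occ I A u
    occ-source-< (edge d Ad≡u u≢j)   Bd≡j       B⇒A = occ-mono-< d B⇒A (u≢j ∘ flip trans Bd≡j ∘ sym) Ad≡u
    occ-source-< (step d Ad≡u u≢b _) (Bd≡b , _) B⇒A = occ-mono-< d B⇒A (u≢b ∘ flip trans Bd≡b ∘ sym) Ad≡u

    data WalkEnd (B : Allotment I) (j : Fin k) : Set where
      closed : ∀ {u a} d (r : Path I A u a) → Unique (vertices I r) → AtTargets B r →
               A d ≡ a → B d ≡ u → WalkEnd B j
      stuck  : ∀ {u} (p : Path I A u j) → Unique (vertices I p) → AtTargets B p →
               (∀ d → B d ≡ u → A d ≡ u) → WalkEnd B j

    walk : ∀ (B : Allotment I) {j} fuel {u} (p : Path I A u j) → Unique (vertices I p) → AtTargets B p →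
           k < length (vertices I p) ℕ.+ fuel → WalkEnd B j
    walk B zero p p-simple _ k<len =
      ⊥-elim (ℕP.<⇒≱ (subst (k <_) (ℕP.+-identityʳ _) k<len) (length-unique-≤ p-simple))
    walk B (suc fuel) {u} p p-simple Bp k<len with moved-into? B u
    ... | inj₂ nothing-moved-in = stuck p p-simple Bp nothing-moved-in
    ... | inj₁ (d , Bd≡u , Ad≢u) with A d ∈? vertices I p
    ...   | yes Ad∈p = let r , r-simple , Br , _ = prefix p Ad∈p Ad≢u p-simple Bp
                       in closed d r r-simple Br refl Bd≡u
    ...   | no  Ad∉p = walk B fuel (step d refl Ad≢u p) (¬Any⇒All¬ _ Ad∉p ∷ p-simple) (Bd≡u , Bp)
                         (subst (k <_) (ℕP.+-suc _ fuel) k<len)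

    walk-from : ∀ B d {j} → B d ≡ j → A d ≢ j → WalkEnd B j
    walk-from B d Bd≡j Ad≢j =
      walk B k (edge d refl Ad≢j) ((Ad≢j ∷ []) ∷ [] ∷ []) Bd≡j (ℕP.m<n+m k (s≤s z≤n))

    module _ (no-negative-loop : ¬ NegativeLoop I A) where

      loopCost-nonneg : (L : Loop I A) → + 0 ℤ.≤ loopCost I L
      loopCost-nonneg L = ℤP.≮⇒≥ (λ L<0 → no-negative-loop (L , L<0))

      record Improvement (B : Allotment I) : Set where
        constructor improvement
        field
          allotment  : Allotment I
          cost-≤     : cost I allotment ≤ cost I B
          distance-< : distance allotment < distance B

      undo-transfer-loop : ∀ B {u a} d (r : Path I A u a) → Unique (vertices I r) → AtTargets B r →
                           A d ≡ a → B d ≡ u → Improvement B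
      undo-transfer-loop B {u} {a} d r r-simple Br Ad≡a Bd≡u =
        improvement R (+≡+δ⇒≤ cost-B (loopCost-nonneg L))
          (ℕP.≤-<-trans (distance-unshift-≤ r B₁) (distance-move-< B d Ad≡a (u≢a ∘ trans (sym Bd≡u))))
        where
        u≢a = source≢target r r-simple
        L : Loop I A
        L = record { i = u ; j = a ; i≢j = u≢a ; path = r ; simple = r-simple
                   ; closing = transferClose d Ad≡a }
        B₁ = move B d a
        R  = unshift r B₁
        Q Q⁺ : Fin k → ℤ
        Q  x = + q x (occ I B x)
        Q⁺ x = + q x (suc (occ I B x))
        δ = edgeCost I d u a ℤ.+ penaltyEdge I B a u
        B₁r : AtTargets B₁ r
        B₁r = AllEdges-zipWith (λ Bd′≡b′ u≢b′ → move-keeps a Bd≡u Bd′≡b′ u≢b′)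
                r Br (source≢targets r r-simple)
        penaltyEdge-B₁ : penaltyEdge I B₁ u a ≡ Q u ℤ.- Q⁺ a
        penaltyEdge-B₁ = cong₂ (λ o o′ → + q u o ℤ.- + q a o′)
          (sym (occ-move-source Bd≡u u≢a)) (occ-move-target Bd≡u u≢a)
        penalties-cancel : ∀ r P ca cu qu qa →
                           r ℤ.+ (P ℤ.- (qu ℤ.- qa)) ℤ.- ((ca ℤ.- cu) ℤ.+ (qa ℤ.- qu))
                         ≡ r ℤ.+ (P ℤ.+ (cu ℤ.- ca))
        penalties-cancel = ℤ-Solver.solve-∀
        cost-B : + cost I B ≡ + cost I R ℤ.+ loopCost I L
        cost-B = begin
          + cost I B
            ≡⟨ cost-before-move Bd≡u u≢a ⟩
          + cost I B₁ ℤ.- δ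
            ≡⟨ cong (ℤ._- δ) (cost-unshift r r-simple B₁r) ⟩
          + cost I R ℤ.+ (pathCost I r ℤ.- penaltyEdge I B₁ u a) ℤ.- δ
            ≡⟨ cong (λ z → + cost I R ℤ.+ (pathCost I r ℤ.- z) ℤ.- δ) penaltyEdge-B₁ ⟩
          + cost I R ℤ.+ (pathCost I r ℤ.- (Q u ℤ.- Q⁺ a)) ℤ.- δ
            ≡⟨ penalties-cancel (+ cost I R) (pathCost I r) (+ CM d a) (+ CM d u) (Q u) (Q⁺ a) ⟩
          + cost I R ℤ.+ (pathCost I r ℤ.+ edgeCost I d a u)
            ∎
          where open ≡-Reasoning

      undo-penalty-loop : ∀ B {u j} (p : Path I A u j) → Unique (vertices I p) → AtTargets B p →
                          occ I B u < occ I A u → occ I A j < occ I B j → Improvement B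
      undo-penalty-loop B {u} {j} p p-simple Bp Bu<Au Aj<Bj =
        improvement (unshift p B) (+≡+δ⇒≤ (cost-unshift p p-simple Bp) 0≤δ) (distance-unshift-< p Bp)
        where
        L : Loop I A
        L = record { i = u ; j = j ; i≢j = source≢target p p-simple ; path = p ; simple = p-simple
                   ; closing = penaltyClose }
        Q Q⁺ : Allotment I → Fin k → ℤ
        Q  X x = + q x (occ I X x)
        Q⁺ X x = + q x (suc (occ I X x))
        regroup : ∀ P qAj qAu qBu qBj →
                  P ℤ.- (qBu ℤ.- qBj) ≡ (P ℤ.+ (qAj ℤ.- qAu)) ℤ.+ ((qBj ℤ.- qAj) ℤ.+ (qAu ℤ.- qBu))
        regroup = ℤ-Solver.solve-∀
        0≤δ : + 0 ℤ.≤ pathCost I p ℤ.- penaltyEdge I B u j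
        0≤δ = subst (+ 0 ℤ.≤_) (sym (regroup (pathCost I p) (Q⁺ A j) (Q A u) (Q⁺ B u) (Q B j)))
          (ℤP.+-mono-≤ (loopCost-nonneg L)
            (ℤP.+-mono-≤ (ℤP.i≤j⇒0≤j-i (ℤ.+≤+ (q-mono-≤ j Aj<Bj)))
                         (ℤP.i≤j⇒0≤j-i (ℤ.+≤+ (q-mono-≤ u Bu<Au)))))

      improve : ∀ B d → A d ≢ B d → Improvement B
      improve B d Ad≢Bd with any? (λ j → occ I A j ℕ.<? occ I B j)
      ... | yes (j , Aj<Bj) with moved-into? B j
      ...   | inj₂ nothing-moved-in = ⊥-elim (ℕP.<⇒≱ Aj<Bj (occ-mono-≤ nothing-moved-in))
      ...   | inj₁ (d′ , Bd′≡j , Ad′≢j) with walk-from B d′ Bd′≡j Ad′≢j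
      ...     | closed d″ r r-simple Br Ad″≡a Bd″≡u = undo-transfer-loop B d″ r r-simple Br Ad″≡a Bd″≡u
      ...     | stuck p p-simple Bp nothing-moved-in =
                  undo-penalty-loop B p p-simple Bp (occ-source-< p Bp nothing-moved-in) Aj<Bj
      improve B d Ad≢Bd | no no-overfull with walk-from B d refl Ad≢Bd
      ... | closed d″ r r-simple Br Ad″≡a Bd″≡u = undo-transfer-loop B d″ r r-simple Br Ad″≡a Bd″≡u
      -- No centre gains units under B and both occupancy vectors sum to n, so none loses any: a stuck
      -- walk is impossible.
      ... | stuck {u} p _ Bp nothing-moved-in = ⊥-elim (ℕP.<-irrefl (trans (sum-occ B) (sym (sum-occ A)))
              (sum-mono-< (λ j → ℕP.≮⇒≥ (no-overfull ∘ (j ,_))) u (occ-source-< p Bp nothing-moved-in)))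

      no-negative-loop⇒optimal : Optimal I A
      no-negative-loop⇒optimal B = bounded (distance B) B ℕP.≤-refl
        where
        bounded : ∀ m B → distance B ≤ m → cost I A ≤ cost I B
        bounded m B B≤m with any? (λ d → ¬? (A d ≟ B d))
        ... | no agree = ℕP.≤-reflexive (cost-cong (λ d → decidable-stable (A d ≟ B d) (agree ∘ (d ,_))))
        bounded zero    B B≤0 | yes (d , Ad≢Bd) = ⊥-elim (ℕP.n≮0 (ℕP.<-≤-trans distance-< B≤0))
          where open Improvement (improve B d Ad≢Bd)
        bounded (suc m) B B≤m | yes (d , Ad≢Bd) =
          ℕP.≤-trans (bounded m allotment (ℕP.≤-pred (ℕP.<-≤-trans distance-< B≤m))) cost-≤
          where open Improvement (improve B d Ad≢Bd)

theorem2 : (I : Instance) (A : Allotment I) →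
    Optimal I A ⇔ (¬ NegativeLoop I A)
theorem2 I A = mk⇔ (optimal⇒no-negative-loop I) (no-negative-loop⇒optimal I)
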